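{- Let $H$ be a crown-free linear $3$-graph having no edge $e$ with $D(e) \geq (4,4,3)$ and no edge $e$ with $D(e) \geq (5,4,2)$. Let $Z$ be the set of vertices of degree at most $3$ and $Y = V(H)\setminus Z$. Let $Z_1$ be the set of vertices of degree $3$, $Z_3$ the set of special vertices, and $Z_2$ the set of non-special vertices of degree $2$. Let $E_1$ be the set of edges of $H$ meeting $Z$ in at least two vertices, and $E_2 = E(H)\setminus E_1$. Then: every $v \in Z_1$ lies in no edge of $E_2$; every $v \in Z_2$ lies in at most one edge of $E_2$; and $|Z_3| \leq |Y|$.
   Context: A (linear) $3$-graph $H=(V,E)$ consists of a finite vertex set $V$ and a set $E$ of $3$-element subsets of $V$ (edges) such that any two distinct edges intersect in at most one vertex; $d(v)=d_H(v)$ is the number of edges containing $v$. A crown is the $3$-graph consisting of three pairwise disjoint edges together with a fourth edge intersecting each of them; $H$ is crown-free if no four edges of $H$ form a crown. For an edge $e=\{a,b,c\}$, $D(e)$ is $(d(a),d(b),d(c))$ sorted in non-increasing order, and $D(e)\geq(x,y,z)$ is meant coordinatewise. A special vertex is a vertex $v$ with $d(v)=2$ such that, writing the two edges containing $v$ as $\{a_1,a_2,v\}$ and $\{b_1,b_2,v\}$, one has $d(a_1)=d(a_2)=d(b_1)=d(b_2)=4$. -}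

module Defs where

open import Data.Nat using (ℕ; zero; suc; _+_; _∸_; _≤_; _≥_; _⊔_; _⊓_; _≟_; _≤?_)
open import Data.Fin using (Fin)
open import Data.Fin.Properties using () renaming (_≟_ to _≟ᶠ_)
open import Data.Product using (_×_; _,_; Σ; ∃-syntax)
open import Data.Sum using (_⊎_)
open import Data.List using (List; length; filter)
open import Data.List.Membership.Propositional using (_∈_)
open import Data.List.Relation.Unary.Unique.Propositional using (Unique)
open import Data.List.Relation.Unary.All using (All; all?)
open import Relation.Binary.PropositionalEquality using (_≡_; _≢_)
open import Relation.Nullary using (¬_; Dec; yes; no)
open import Relation.Nullary.Decidable using (_×-dec_; _⊎-dec_; ¬?; _→-dec_)
open import Data.Vec.Functional using () 
open import Data.List using (allFin) public

-- An (unordered) edge on vertex set Fin n, given by its three vertices.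
Edge : ℕ → Set
Edge n = Fin n × Fin n × Fin n

_∈ₑ_ : ∀ {n} → Fin n → Edge n → Set
v ∈ₑ (a , b , c) = v ≡ a ⊎ v ≡ b ⊎ v ≡ c

_∈ₑ?_ : ∀ {n} (v : Fin n) (e : Edge n) → Dec (v ∈ₑ e)
v ∈ₑ? (a , b , c) = (v ≟ᶠ a) ⊎-dec ((v ≟ᶠ b) ⊎-dec (v ≟ᶠ c))

shared : ∀ {n} → Edge n → Edge n → ℕ
shared (a , b , c) f = ind a + ind b + ind c
  where
  ind : _ → ℕ
  ind x with x ∈ₑ? f
  ... | yes _ = 1
  ... | no  _ = 0

-- A linear 3-graph on vertex set Fin n: a duplicate-free list of edges, each
-- consisting of three distinct vertices, any two distinct edges sharing at most
-- one vertex.  (Two listings of the same 3-set share 3 vertices, so linearity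
-- also forbids repeated edges in different orders.)
record Linear3Graph (n : ℕ) : Set where
  field
    edges    : List (Edge n)
    distinct : ∀ {a b c} → (a , b , c) ∈ edges → a ≢ b × a ≢ c × b ≢ c
    unique   : Unique edges
    linear   : ∀ {e f} → e ∈ edges → f ∈ edges → e ≢ f → shared e f ≤ 1

module _ {n : ℕ} (H : Linear3Graph n) where
  open Linear3Graph H

  deg : Fin n → ℕ
  deg v = length (filter (v ∈ₑ?_) edges)

  Meets : Edge n → Edge n → Set
  Meets e f = ¬ (shared e f ≡ 0)

  Disjoint : Edge n → Edge n → Set
  Disjoint e f = shared e f ≡ 0

  CrownFree : Set
  CrownFree = ¬ (∃[ e0 ] ∃[ e1 ] ∃[ e2 ] ∃[ e3 ]
                  (e0 ∈ edges × e1 ∈ edges × e2 ∈ edges × e3 ∈ edges ×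
                   Disjoint e1 e2 × Disjoint e1 e3 × Disjoint e2 e3 ×
                   Meets e0 e1 × Meets e0 e2 × Meets e0 e3))

  -- D(e): degrees of the vertices of e sorted non-increasingly
  sort3 : ℕ → ℕ → ℕ → ℕ × ℕ × ℕ
  sort3 x y z = (x ⊔ y ⊔ z) , ((x + y + z) ∸ (x ⊔ y ⊔ z) ∸ (x ⊓ y ⊓ z)) , (x ⊓ y ⊓ z)

  D : Edge n → ℕ × ℕ × ℕ
  D (a , b , c) = sort3 (deg a) (deg b) (deg c)

  _≥₃_ : ℕ × ℕ × ℕ → ℕ × ℕ × ℕ → Set
  (x₁ , x₂ , x₃) ≥₃ (y₁ , y₂ , y₃) = x₁ ≥ y₁ × x₂ ≥ y₂ × x₃ ≥ y₃

  OthersDeg4 : Fin n → Edge n → Set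
  OthersDeg4 v (a , b , c) = (a ≢ v → deg a ≡ 4) × (b ≢ v → deg b ≡ 4) × (c ≢ v → deg c ≡ 4)

  OthersDeg4? : ∀ v e → Dec (OthersDeg4 v e)
  OthersDeg4? v (a , b , c) =
    (¬? (a ≟ᶠ v) →-dec (deg a ≟ 4)) ×-dec
    ((¬? (b ≟ᶠ v) →-dec (deg b ≟ 4)) ×-dec (¬? (c ≟ᶠ v) →-dec (deg c ≟ 4)))

  Special : Fin n → Set
  Special v = deg v ≡ 2 × All (λ e → v ∈ₑ e → OthersDeg4 v e) edges

  Special? : ∀ v → Dec (Special v)
  Special? v = (deg v ≟ 2) ×-dec all? (λ e → (v ∈ₑ? e) →-dec OthersDeg4? v e) edges

  InZ? : ∀ v → Dec (deg v ≤ 3)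
  InZ? v = deg v ≤? 3

  InY? : ∀ v → Dec (¬ (deg v ≤ 3))
  InY? v = ¬? (InZ? v)

  zcount : Edge n → ℕ
  zcount (a , b , c) = ind a + ind b + ind c
    where
    ind : Fin n → ℕ
    ind x with InZ? x
    ... | yes _ = 1
    ... | no  _ = 0

  InE₁ : Edge n → Set
  InE₁ e = 2 ≤ zcount e

  InE₂ : Edge n → Set
  InE₂ e = ¬ InE₁ e

  InE₂? : ∀ e → Dec (InE₂ e)
  InE₂? e = ¬? (2 ≤? zcount e)

  degE₂ : Fin n → ℕ
  degE₂ v = length (filter (λ e → (v ∈ₑ? e) ×-dec InE₂? e) edges)

  #Z₃ : ℕ
  #Z₃ = length (filter Special? (allFin n))

  #Y : ℕ
  #Y = length (filter InY? (allFin n))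

{-# OPTIONS --safe #-}
-- If an edge e of E₂ contains a vertex v of Z, its two other vertices lie in Y, so
-- D(e) ≥ (4, 4, deg v).  For deg v = 3 this is excluded outright; for deg v = 2,
-- excluding D(e) ≥ (5, 4, 2) forces both other vertices to have degree exactly 4, so a
-- degree-2 vertex lying in two E₂-edges is special.  For |Z₃| ≤ |Y| double count the
-- pairs (y, e) with y ∈ Y ∩ e and e meeting Z₃: every special vertex lies in two edges,
-- each of which contains no other special vertex and two vertices of degree 4, giving at
-- least 2·2|Z₃| pairs; and a y ∈ Y in such an edge has degree 4, giving at most 4|Y|.
module Submission where

open import Defs
open import Data.Nat using (ℕ; _≤_)
open import Data.Fin using (Fin)
open import Data.Product using (_×_; _,_)
open import Data.List.Membership.Propositional using (_∈_)
open import Relation.Binary.PropositionalEquality using (_≡_)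
open import Relation.Nullary using (¬_)

open import Level using (0ℓ)
open import Data.Nat using (suc; _+_; _*_; _∸_; _<_; _⊔_; _⊓_; z≤n; s≤s)
open import Data.Nat.Properties
open import Data.Nat.ListAction using (sum)
open import Data.Fin using () renaming (_≟_ to _≟ᶠ_)
open import Data.Product using (proj₁; proj₂; ∃-syntax)
open import Data.Sum using (_⊎_; inj₁; inj₂)
open import Function using (_∘_)
open import Data.List using (List; []; _∷_; length; filter; map)
open import Data.List.Properties using (filter-none; map-cong)
open import Data.List.Membership.Propositional using (find)
open import Data.List.Membership.Propositional.Properties using (∈-filter⁺; ∈-filter⁻; ∈-allFin)
open import Data.List.Relation.Unary.Any using (Any; here; there; any?)
open import Data.List.Relation.Unary.All as All using (All; _∷_)
open import Data.List.Relation.Unary.All.Properties using (¬Any⇒All¬)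
open import Data.List.Relation.Unary.AllPairs using (_∷_)
open import Data.List.Relation.Unary.Unique.Propositional using (Unique)
import Data.List.Relation.Unary.Unique.Propositional.Properties as Unique
open import Data.List.Relation.Binary.Sublist.Propositional using (⊆-refl)
open import Data.List.Relation.Binary.Sublist.Propositional.Properties using (filter⁺)
open import Data.List.Relation.Binary.Sublist.Heterogeneous.Properties using (length-mono-≤)
open import Relation.Binary.PropositionalEquality
  using (_≢_; refl; sym; trans; cong; cong₂; subst; ≢-sym; module ≡-Reasoning)
open import Relation.Nullary using (Dec; yes; no; contradiction)
open import Relation.Nullary.Decidable using (_×-dec_)
open import Relation.Unary using (Pred; Decidable; _⊆_; ∁)
open import Relation.Unary.Properties using (_∩?_)
import Algebra.Properties.CommutativeSemigroup as CommSemigroupProperties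
open CommSemigroupProperties +-commutativeSemigroup using (interchange; xy∙z≈xz∙y)
open CommSemigroupProperties +-commutativeSemigroup using () renaming (xy∙z≈yz∙x to +-rotate)
open CommSemigroupProperties ⊔-commutativeSemigroup using () renaming (xy∙z≈yz∙x to ⊔-rotate)
open CommSemigroupProperties ⊓-commutativeSemigroup using () renaming (xy∙z≈yz∙x to ⊓-rotate)

indicator : {P : Set} → Dec P → ℕ
indicator (yes _) = 1
indicator (no _) = 0

module _ {A : Set} where

  count : {P : Pred A 0ℓ} → Decidable P → List A → ℕ
  count P? xs = length (filter P? xs)

  length≥2 : ∀ {x y} {ys : List A} → x ∈ ys → y ∈ ys → x ≢ y → 2 ≤ length ys
  length≥2 {ys = _ ∷ _ ∷ _} _ _ _ = s≤s (s≤s z≤n)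
  length≥2 {ys = _ ∷ []} (here refl) (here refl) x≢y = contradiction refl x≢y

  length≤1 : {ys : List A} → Unique ys → (∀ {x y} → x ∈ ys → y ∈ ys → x ≡ y) → length ys ≤ 1
  length≤1 {[]} _ _ = z≤n
  length≤1 {_ ∷ []} _ _ = s≤s z≤n
  length≤1 {_ ∷ _ ∷ _} ((x≢y ∷ _) ∷ _) all≡ = contradiction (all≡ (here refl) (there (here refl))) x≢y

  count-mono : ∀ {P Q : Pred A 0ℓ} (P? : Decidable P) (Q? : Decidable Q) →
               P ⊆ Q → ∀ xs → count P? xs ≤ count Q? xs
  count-mono P? Q? P⊆Q xs = length-mono-≤ (filter⁺ P? Q? (λ { refl → P⊆Q }) (⊆-refl {x = xs}))

  module _ {P : Pred A 0ℓ} (P? : Decidable P) where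

    count-∷ : ∀ x xs → count P? (x ∷ xs) ≡ indicator (P? x) + count P? xs
    count-∷ x xs with P? x
    ... | yes _ = refl
    ... | no _ = refl

    sum-indicator≡count : ∀ xs → sum (map (λ x → indicator (P? x)) xs) ≡ count P? xs
    sum-indicator≡count [] = refl
    sum-indicator≡count (x ∷ xs) =
      trans (cong (indicator (P? x) +_) (sum-indicator≡count xs)) (sym (count-∷ x xs))

    count-none : ∀ {xs} → All (∁ P) xs → count P? xs ≡ 0
    count-none ¬ps = cong length (filter-none P? ¬ps)

    count≡0⊎any : ∀ xs → count P? xs ≡ 0 ⊎ Any P xs
    count≡0⊎any xs with any? P? xs
    ... | yes some = inj₂ some
    ... | no none = inj₁ (count-none (¬Any⇒All¬ xs none))

    count-≥2 : ∀ {x y xs} → x ≢ y → x ∈ xs → y ∈ xs → P x → P y → 2 ≤ count P? xs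
    count-≥2 x≢y x∈ y∈ px py = length≥2 (∈-filter⁺ P? x∈ px) (∈-filter⁺ P? y∈ py) x≢y

    count-≤1 : ∀ {xs} → Unique xs → (∀ {x y} → P x → P y → x ≡ y) → count P? xs ≤ 1
    count-≤1 {xs} uniq p≡ = length≤1 (Unique.filter⁺ P? uniq) λ x∈ y∈ →
      p≡ (proj₂ (∈-filter⁻ P? {xs = xs} x∈)) (proj₂ (∈-filter⁻ P? {xs = xs} y∈))

    count-∩<count : ∀ {Q : Pred A 0ℓ} (Q? : Decidable Q) {x xs} →
                    x ∈ xs → P x → ¬ Q x → count (P? ∩? Q?) xs < count P? xs
    count-∩<count Q? {xs = y ∷ ys} (here refl) py ¬qy with P? y | Q? y
    ... | yes _ | yes qy = contradiction qy ¬qy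
    ... | yes _ | no _ = s≤s (count-mono (P? ∩? Q?) P? proj₁ ys)
    ... | no ¬py | _ = contradiction py ¬py
    count-∩<count Q? {xs = y ∷ ys} (there x∈) px ¬qx with P? y | Q? y
    ... | yes _ | yes _ = s≤s (count-∩<count Q? x∈ px ¬qx)
    ... | yes _ | no _ = m≤n⇒m≤1+n (count-∩<count Q? x∈ px ¬qx)
    ... | no _ | _ = count-∩<count Q? x∈ px ¬qx

    *-count≤sum : ∀ {f : A → ℕ} k → (∀ {x} → P x → k ≤ f x) → ∀ xs → k * count P? xs ≤ sum (map f xs)
    *-count≤sum k k≤f [] = ≤-reflexive (*-zeroʳ k)
    *-count≤sum {f} k k≤f (x ∷ xs) with P? x
    ... | yes px = begin
      k * suc (count P? xs)  ≡⟨ *-suc k _ ⟩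
      k + k * count P? xs    ≤⟨ +-mono-≤ (k≤f px) (*-count≤sum k k≤f xs) ⟩
      f x + sum (map f xs)   ∎
      where open ≤-Reasoning
    ... | no _ = ≤-trans (*-count≤sum k k≤f xs) (m≤n+m _ (f x))

    sum≤*-count : ∀ {f : A → ℕ} k → (∀ x → f x ≤ k) → (∀ {x} → ¬ P x → f x ≡ 0) →
                  ∀ xs → sum (map f xs) ≤ k * count P? xs
    sum≤*-count k f≤k f≡0 [] = z≤n
    sum≤*-count {f} k f≤k f≡0 (x ∷ xs) with P? x
    ... | yes _ = begin
      f x + sum (map f xs)   ≤⟨ +-mono-≤ (f≤k x) (sum≤*-count k f≤k f≡0 xs) ⟩
      k + k * count P? xs    ≡⟨ *-suc k _ ⟨
      k * suc (count P? xs)  ∎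
      where open ≤-Reasoning
    ... | no ¬px = subst (λ t → t + sum (map f xs) ≤ _) (sym (f≡0 ¬px)) (sum≤*-count k f≤k f≡0 xs)

  sum-map-mono : ∀ {f g : A → ℕ} xs → (∀ {x} → x ∈ xs → f x ≤ g x) → sum (map f xs) ≤ sum (map g xs)
  sum-map-mono [] _ = z≤n
  sum-map-mono (x ∷ xs) f≤g = +-mono-≤ (f≤g (here refl)) (sum-map-mono xs (λ x∈ → f≤g (there x∈)))

  *-sum-map : ∀ k (f : A → ℕ) xs → k * sum (map f xs) ≡ sum (map (λ x → k * f x) xs)
  *-sum-map k f [] = *-zeroʳ k
  *-sum-map k f (x ∷ xs) = trans (*-distribˡ-+ k (f x) _) (cong (k * f x +_) (*-sum-map k f xs))

  sum-map-+ : ∀ (f g : A → ℕ) xs → sum (map (λ x → f x + g x) xs) ≡ sum (map f xs) + sum (map g xs)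
  sum-map-+ f g [] = refl
  sum-map-+ f g (x ∷ xs) =
    trans (cong (f x + g x +_) (sum-map-+ f g xs)) (interchange (f x) (g x) _ _)

module _ {A B : Set} {R : A → B → Set} (R? : ∀ a b → Dec (R a b)) where

  sum-count-swap : ∀ as bs →
    sum (map (λ a → count (R? a) bs) as) ≡ sum (map (λ b → count (λ a → R? a b) as) bs)
  sum-count-swap as [] = sum-zeros as
    where
    sum-zeros : ∀ as → sum (map (λ a → count (R? a) []) as) ≡ 0
    sum-zeros [] = refl
    sum-zeros (_ ∷ as) = sum-zeros as
  sum-count-swap as (b ∷ bs) = begin
    sum (map (λ a → count (R? a) (b ∷ bs)) as)
      ≡⟨ cong sum (map-cong (λ a → count-∷ (R? a) b bs) as) ⟩
    sum (map (λ a → indicator (R? a b) + count (R? a) bs) as)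
      ≡⟨ sum-map-+ _ _ as ⟩
    sum (map (λ a → indicator (R? a b)) as) + sum (map (λ a → count (R? a) bs) as)
      ≡⟨ cong₂ _+_ (sum-indicator≡count (λ a → R? a b) as) (sum-count-swap as bs) ⟩
    count (λ a → R? a b) as + sum (map (λ b → count (λ a → R? a b) as) bs) ∎
    where open ≡-Reasoning

⊓+⊔ : ∀ x y → x ⊓ y + (x ⊔ y) ≡ x + y
⊓+⊔ x y with ≤-total x y
... | inj₁ x≤y = cong₂ _+_ (m≤n⇒m⊓n≡m x≤y) (m≤n⇒m⊔n≡n x≤y)
... | inj₂ y≤x = trans (cong₂ _+_ (m≥n⇒m⊓n≡n y≤x) (m≥n⇒m⊔n≡m y≤x)) (+-comm y x)

median : ℕ → ℕ → ℕ → ℕ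
median x y z = x + y + z ∸ (x ⊔ y ⊔ z) ∸ (x ⊓ y ⊓ z)

median-rotate : ∀ x y z → median x y z ≡ median y z x
median-rotate x y z
  rewrite +-rotate x y z | ⊔-rotate x y z | ⊓-rotate x y z = refl

⊓≤median : ∀ x y z → x ⊓ y ≤ median x y z
⊓≤median x y z = m+n≤o⇒m≤o∸n (x ⊓ y) (m+n≤o⇒m≤o∸n _ (min+max-bound (≤-total z (x ⊓ y))))
  where
  open ≤-Reasoning
  min+max-bound : z ≤ x ⊓ y ⊎ x ⊓ y ≤ z → x ⊓ y + x ⊓ y ⊓ z + (x ⊔ y ⊔ z) ≤ x + y + z
  min+max-bound (inj₁ z≤xy)
    rewrite m≥n⇒m⊓n≡n z≤xy | m≥n⇒m⊔n≡m (≤-trans z≤xy (m⊓n≤m⊔n x y)) = begin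
    x ⊓ y + z + (x ⊔ y)  ≡⟨ xy∙z≈xz∙y (x ⊓ y) z (x ⊔ y) ⟩
    x ⊓ y + (x ⊔ y) + z  ≡⟨ cong (_+ z) (⊓+⊔ x y) ⟩
    x + y + z            ∎
  min+max-bound (inj₂ xy≤z) rewrite m≤n⇒m⊓n≡m xy≤z = begin
    x ⊓ y + x ⊓ y + (x ⊔ y ⊔ z)          ≤⟨ +-monoˡ-≤ _ (+-monoʳ-≤ (x ⊓ y) (⊓-glb (m⊓n≤m⊔n x y) xy≤z)) ⟩
    x ⊓ y + (x ⊔ y) ⊓ z + (x ⊔ y ⊔ z)    ≡⟨ +-assoc (x ⊓ y) _ _ ⟩
    x ⊓ y + ((x ⊔ y) ⊓ z + (x ⊔ y ⊔ z))  ≡⟨ cong (x ⊓ y +_) (⊓+⊔ (x ⊔ y) z) ⟩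
    x ⊓ y + (x ⊔ y + z)                  ≡⟨ +-assoc (x ⊓ y) _ _ ⟨
    x ⊓ y + (x ⊔ y) + z                  ≡⟨ cong (_+ z) (⊓+⊔ x y) ⟩
    x + y + z                            ∎

module _ {n : ℕ} (H : Linear3Graph n) where
  open Linear3Graph H

  vertices : Edge n → List (Fin n)
  vertices (a , b , c) = a ∷ b ∷ c ∷ []

  ∈ₑ⇒∈vertices : ∀ {v} e → v ∈ₑ e → v ∈ vertices e
  ∈ₑ⇒∈vertices (a , b , c) (inj₁ refl) = here refl
  ∈ₑ⇒∈vertices (a , b , c) (inj₂ (inj₁ refl)) = there (here refl)
  ∈ₑ⇒∈vertices (a , b , c) (inj₂ (inj₂ refl)) = there (there (here refl))

  others : ∀ {e v} → e ∈ edges → v ∈ₑ e →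
           ∃[ x ] ∃[ y ] x ∈ₑ e × y ∈ₑ e × x ≢ v × y ≢ v × x ≢ y
  others {a , b , c} e∈ v∈ with distinct e∈ | v∈
  ... | a≢b , a≢c , b≢c | inj₁ refl =
    b , c , inj₂ (inj₁ refl) , inj₂ (inj₂ refl) , ≢-sym a≢b , ≢-sym a≢c , b≢c
  ... | a≢b , a≢c , b≢c | inj₂ (inj₁ refl) =
    a , c , inj₁ refl , inj₂ (inj₂ refl) , a≢b , ≢-sym b≢c , a≢c
  ... | a≢b , a≢c , b≢c | inj₂ (inj₂ refl) =
    a , b , inj₁ refl , inj₂ (inj₁ refl) , a≢c , b≢c , a≢b

  OthersDeg4-intro : ∀ {v} e → (∀ {u} → u ∈ₑ e → u ≢ v → deg H u ≡ 4) → OthersDeg4 H v e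
  OthersDeg4-intro (a , b , c) deg4 = deg4 (inj₁ refl) , deg4 (inj₂ (inj₁ refl)) , deg4 (inj₂ (inj₂ refl))

  OthersDeg4-elim : ∀ {v u} e → OthersDeg4 H v e → u ∈ₑ e → u ≢ v → deg H u ≡ 4
  OthersDeg4-elim (a , b , c) (deg4 , _ , _) (inj₁ refl) = deg4
  OthersDeg4-elim (a , b , c) (_ , deg4 , _) (inj₂ (inj₁ refl)) = deg4
  OthersDeg4-elim (a , b , c) (_ , _ , deg4) (inj₂ (inj₂ refl)) = deg4

  deg≤max : ∀ {w} e → w ∈ₑ e → deg H w ≤ proj₁ (D H e)
  deg≤max (a , b , c) (inj₁ refl) = ≤-trans (m≤m⊔n _ _) (m≤m⊔n _ _)
  deg≤max (a , b , c) (inj₂ (inj₁ refl)) = ≤-trans (m≤n⊔m (deg H a) _) (m≤m⊔n _ _)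
  deg≤max (a , b , c) (inj₂ (inj₂ refl)) = m≤n⊔m _ _

  deg≥min : ∀ {C} e → (∀ {u} → u ∈ₑ e → C ≤ deg H u) → C ≤ proj₂ (proj₂ (D H e))
  deg≥min (a , b , c) C≤ = ⊓-glb (⊓-glb (C≤ (inj₁ refl)) (C≤ (inj₂ (inj₁ refl)))) (C≤ (inj₂ (inj₂ refl)))

  others≥⇒median≥ : ∀ {B e v} → e ∈ edges → v ∈ₑ e → (∀ {u} → u ∈ₑ e → u ≢ v → B ≤ deg H u) →
                    B ≤ proj₁ (proj₂ (D H e))
  others≥⇒median≥ {B} {a , b , c} e∈ v∈ B≤ with distinct e∈ | v∈
  ... | a≢b , a≢c , b≢c | inj₁ refl = begin
    B                                     ≤⟨ ⊓-glb (B≤ (inj₂ (inj₁ refl)) (≢-sym a≢b))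
                                                   (B≤ (inj₂ (inj₂ refl)) (≢-sym a≢c)) ⟩
    deg H b ⊓ deg H c                     ≤⟨ ⊓≤median _ _ _ ⟩
    median (deg H b) (deg H c) (deg H a)  ≡⟨ median-rotate (deg H a) _ _ ⟨
    median (deg H a) (deg H b) (deg H c)  ∎
    where open ≤-Reasoning
  ... | a≢b , a≢c , b≢c | inj₂ (inj₁ refl) = begin
    B                                     ≤⟨ ⊓-glb (B≤ (inj₂ (inj₂ refl)) (≢-sym b≢c)) (B≤ (inj₁ refl) a≢b) ⟩
    deg H c ⊓ deg H a                     ≤⟨ ⊓≤median _ _ _ ⟩
    median (deg H c) (deg H a) (deg H b)  ≡⟨ trans (median-rotate (deg H a) _ _)
                                                   (median-rotate (deg H b) _ _) ⟨
    median (deg H a) (deg H b) (deg H c)  ∎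
    where open ≤-Reasoning
  ... | a≢b , a≢c , b≢c | inj₂ (inj₂ refl) =
    ≤-trans (⊓-glb (B≤ (inj₁ refl) a≢c) (B≤ (inj₂ (inj₁ refl)) b≢c)) (⊓≤median _ _ _)

  D-≥₃ : ∀ {e v w A B C} → e ∈ edges → v ∈ₑ e → w ∈ₑ e → A ≤ deg H w →
         (∀ {u} → u ∈ₑ e → u ≢ v → B ≤ deg H u) → C ≤ deg H v → C ≤ B → _≥₃_ H (D H e) (A , B , C)
  D-≥₃ {a , b , c} {v} e∈ v∈ w∈ A≤w B≤ C≤v C≤B =
    ≤-trans A≤w (deg≤max _ w∈) , others≥⇒median≥ e∈ v∈ B≤ , deg≥min _ C≤
    where
    C≤ : ∀ {u} → u ∈ₑ (a , b , c) → _ ≤ deg H u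
    C≤ {u} u∈ with u ≟ᶠ v
    ... | yes refl = C≤v
    ... | no u≢v = ≤-trans C≤B (B≤ u∈ u≢v)

  -- `zcount` counts through a local indicator, which only unfolds once all three
  -- membership tests are decided.
  zcount≡sum-indicator : ∀ e → zcount H e ≡ sum (map (λ x → indicator (InZ? H x)) (vertices e))
  zcount≡sum-indicator (a , b , c) with InZ? H a | InZ? H b | InZ? H c
  ... | yes _ | yes _ | yes _ = refl
  ... | yes _ | yes _ | no _  = refl
  ... | yes _ | no _  | yes _ = refl
  ... | yes _ | no _  | no _  = refl
  ... | no _  | yes _ | yes _ = refl
  ... | no _  | yes _ | no _  = refl
  ... | no _  | no _  | yes _ = refl
  ... | no _  | no _  | no _  = refl

  E₂-others-in-Y : ∀ {e v u} → InE₂ H e → v ∈ₑ e → deg H v ≤ 3 → u ∈ₑ e → u ≢ v → 4 ≤ deg H u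
  E₂-others-in-Y {e} e₂ v∈ v∈Z u∈ u≢v = ≰⇒> λ u∈Z →
    e₂ (subst (2 ≤_) (sym (trans (zcount≡sum-indicator e) (sum-indicator≡count (InZ? H) (vertices e))))
         (count-≥2 (InZ? H) u≢v (∈ₑ⇒∈vertices e u∈) (∈ₑ⇒∈vertices e v∈) u∈Z v∈Z))

  E₂-edge-at-deg3-vertex : ∀ {e v} → e ∈ edges → v ∈ₑ e → deg H v ≡ 3 → InE₂ H e →
                           _≥₃_ H (D H e) (4 , 4 , 3)
  E₂-edge-at-deg3-vertex {e} {v} e∈ v∈ d3 e₂ with others e∈ v∈
  ... | x , _ , x∈ , _ , x≢v , _ =
    D-≥₃ e∈ v∈ x∈ (in-Y x∈ x≢v) in-Y (≤-reflexive (sym d3)) (n≤1+n 3)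
    where
    in-Y : ∀ {u} → u ∈ₑ e → u ≢ v → 4 ≤ deg H u
    in-Y = E₂-others-in-Y e₂ v∈ (≤-reflexive d3)

  E₂-edge-at-deg2-vertex : (∀ e → e ∈ edges → ¬ (_≥₃_ H (D H e) (5 , 4 , 2))) →
                           ∀ {e v} → e ∈ edges → v ∈ₑ e → deg H v ≡ 2 → InE₂ H e → OthersDeg4 H v e
  E₂-edge-at-deg2-vertex no542 {e} {v} e∈ v∈ d2 e₂ = OthersDeg4-intro e λ u∈ u≢v →
    ≤-antisym (≮⇒≥ λ 4<u → no542 e e∈ (D-≥₃ e∈ v∈ u∈ 4<u in-Y (≤-reflexive (sym d2)) (m≤m+n 2 2)))
              (in-Y u∈ u≢v)
    where
    in-Y : ∀ {u} → u ∈ₑ e → u ≢ v → 4 ≤ deg H u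
    in-Y = E₂-others-in-Y e₂ v∈ (≤-trans (≤-reflexive d2) (n≤1+n 2))

  deg3⇒degE₂≡0 : (∀ e → e ∈ edges → ¬ (_≥₃_ H (D H e) (4 , 4 , 3))) →
                 ∀ v → deg H v ≡ 3 → degE₂ H v ≡ 0
  deg3⇒degE₂≡0 no443 v d3 =
    count-none (λ e → (v ∈ₑ? e) ×-dec InE₂? H e) {edges} (All.tabulate λ {e} e∈ (v∈ , e₂) →
      no443 e e∈ (E₂-edge-at-deg3-vertex e∈ v∈ d3 e₂))

  deg≤degE₂⇒InE₂ : ∀ {v e} → deg H v ≤ degE₂ H v → e ∈ edges → v ∈ₑ e → InE₂ H e
  deg≤degE₂⇒InE₂ {v} deg≤ e∈ v∈ e₁ =
    <⇒≱ (count-∩<count (v ∈ₑ?_) (InE₂? H) e∈ v∈ (λ e₂ → e₂ e₁)) deg≤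

  deg2-nonspecial⇒degE₂≤1 : (∀ e → e ∈ edges → ¬ (_≥₃_ H (D H e) (5 , 4 , 2))) →
                            ∀ v → deg H v ≡ 2 → ¬ Special H v → degE₂ H v ≤ 1
  deg2-nonspecial⇒degE₂≤1 no542 v d2 ¬special = ≮⇒≥ λ 1<degE₂ →
    ¬special (d2 , All.tabulate λ e∈ v∈ →
      E₂-edge-at-deg2-vertex no542 e∈ v∈ d2
        (deg≤degE₂⇒InE₂ (subst (_≤ degE₂ H v) (sym d2) 1<degE₂) e∈ v∈))

  Z₃Incident : Fin n → Edge n → Set
  Z₃Incident v e = Special H v × v ∈ₑ e

  Z₃Incident? : ∀ v e → Dec (Z₃Incident v e)
  Z₃Incident? v e = Special? H v ×-dec (v ∈ₑ? e)

  MeetsZ₃ : Edge n → Set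
  MeetsZ₃ e = Any (λ w → Z₃Incident w e) (allFin n)

  YIncidentViaZ₃ : Fin n → Edge n → Set
  YIncidentViaZ₃ y e = ¬ deg H y ≤ 3 × y ∈ₑ e × MeetsZ₃ e

  YIncidentViaZ₃? : ∀ y e → Dec (YIncidentViaZ₃ y e)
  YIncidentViaZ₃? y e = InY? H y ×-dec ((y ∈ₑ? e) ×-dec any? (λ w → Z₃Incident? w e) (allFin n))

  Z₃-neighbour-deg4 : ∀ {w u e} → Special H w → e ∈ edges → w ∈ₑ e → u ∈ₑ e → u ≢ w → deg H u ≡ 4
  Z₃-neighbour-deg4 {e = e} (_ , around) e∈ w∈ = OthersDeg4-elim e (All.lookup around e∈ w∈)

  Z₃⊆Z : ∀ {w} → Special H w → deg H w ≤ 3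
  Z₃⊆Z (d2 , _) = ≤-trans (≤-reflexive d2) (n≤1+n 2)

  deg4∉Z : ∀ {u} → deg H u ≡ 4 → ¬ deg H u ≤ 3
  deg4∉Z d4 u∈Z = 1+n≰n (subst (_≤ 3) d4 u∈Z)

  Z₃Incident-unique : ∀ {e u u′} → e ∈ edges → Z₃Incident u e → Z₃Incident u′ e → u ≡ u′
  Z₃Incident-unique {u = u} {u′} e∈ (special-u , u∈) (special-u′ , u′∈) with u ≟ᶠ u′
  ... | yes u≡u′ = u≡u′
  ... | no u≢u′ =
    contradiction (trans (sym (proj₁ special-u)) (Z₃-neighbour-deg4 special-u′ e∈ u′∈ u∈ u≢u′)) λ ()

  Z₃-vertex-incidences : ∀ {v} → Special H v → 2 ≤ count (Z₃Incident? v) edges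
  Z₃-vertex-incidences {v} special =
    subst (_≤ count (Z₃Incident? v) edges) (proj₁ special)
          (count-mono (v ∈ₑ?_) (Z₃Incident? v) (special ,_) edges)

  Y-vertex-incidences≤4 : ∀ y → count (YIncidentViaZ₃? y) edges ≤ 4
  Y-vertex-incidences≤4 y with count≡0⊎any (YIncidentViaZ₃? y) edges
  ... | inj₁ none rewrite none = z≤n
  ... | inj₂ some with find some
  ...   | e , e∈ , y∉Z , y∈ , meets with find meets
  ...     | w , _ , special , w∈ = begin
    count (YIncidentViaZ₃? y) edges  ≤⟨ count-mono (YIncidentViaZ₃? y) (y ∈ₑ?_) (proj₁ ∘ proj₂) edges ⟩
    deg H y                          ≡⟨ Z₃-neighbour-deg4 special e∈ w∈ y∈ y≢w ⟩
    4                                ∎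
    where
    open ≤-Reasoning
    y≢w : y ≢ w
    y≢w refl = y∉Z (Z₃⊆Z special)

  Z₃-incidences-per-edge : ∀ {e} → e ∈ edges →
    2 * count (λ v → Z₃Incident? v e) (allFin n) ≤ count (λ y → YIncidentViaZ₃? y e) (allFin n)
  Z₃-incidences-per-edge {e} e∈ with count≡0⊎any (λ v → Z₃Incident? v e) (allFin n)
  ... | inj₁ none rewrite none = z≤n
  ... | inj₂ meets with find meets
  ...   | w , _ , special , w∈ with others e∈ w∈
  ...     | x , y , x∈ , y∈ , x≢w , y≢w , x≢y = begin
    2 * count (λ v → Z₃Incident? v e) (allFin n)  ≤⟨ *-monoʳ-≤ 2 at-most-one ⟩
    2                                             ≤⟨ count-≥2 (λ y → YIncidentViaZ₃? y e) x≢y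
                                                       (∈-allFin x) (∈-allFin y) (in-Y x∈ x≢w) (in-Y y∈ y≢w) ⟩
    count (λ y → YIncidentViaZ₃? y e) (allFin n)  ∎
    where
    open ≤-Reasoning
    in-Y : ∀ {u} → u ∈ₑ e → u ≢ w → YIncidentViaZ₃ u e
    in-Y u∈ u≢w = deg4∉Z (Z₃-neighbour-deg4 special e∈ w∈ u∈ u≢w) , u∈ , meets
    at-most-one : count (λ v → Z₃Incident? v e) (allFin n) ≤ 1
    at-most-one = count-≤1 (λ v → Z₃Incident? v e) (Unique.allFin⁺ n) (Z₃Incident-unique e∈)

  #Z₃≤#Y : #Z₃ H ≤ #Y H
  #Z₃≤#Y = *-cancelˡ-≤ 4 (begin
    4 * #Z₃ H
      ≡⟨ *-assoc 2 2 (#Z₃ H) ⟩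
    2 * (2 * #Z₃ H)
      ≤⟨ *-monoʳ-≤ 2 (*-count≤sum (Special? H) 2 Z₃-vertex-incidences (allFin n)) ⟩
    2 * sum (map (λ v → count (Z₃Incident? v) edges) (allFin n))
      ≡⟨ cong (2 *_) (sum-count-swap Z₃Incident? (allFin n) edges) ⟩
    2 * sum (map (λ e → count (λ v → Z₃Incident? v e) (allFin n)) edges)
      ≡⟨ *-sum-map 2 _ edges ⟩
    sum (map (λ e → 2 * count (λ v → Z₃Incident? v e) (allFin n)) edges)
      ≤⟨ sum-map-mono edges Z₃-incidences-per-edge ⟩
    sum (map (λ e → count (λ y → YIncidentViaZ₃? y e) (allFin n)) edges)
      ≡⟨ sum-count-swap YIncidentViaZ₃? (allFin n) edges ⟨
    sum (map (λ y → count (YIncidentViaZ₃? y) edges) (allFin n))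
      ≤⟨ sum≤*-count (InY? H) 4 Y-vertex-incidences≤4 outside-Y (allFin n) ⟩
    4 * #Y H ∎)
    where
    open ≤-Reasoning
    outside-Y : ∀ {y} → ¬ ¬ deg H y ≤ 3 → count (YIncidentViaZ₃? y) edges ≡ 0
    outside-Y {y} y∉Y = count-none (YIncidentViaZ₃? y) {edges} (All.tabulate λ _ i → y∉Y (proj₁ i))

proposition5p1 : ∀ {n : ℕ} (H : Linear3Graph n) →
    CrownFree H →
    (∀ e → e ∈ Linear3Graph.edges H → ¬ (_≥₃_ H (D H e) (4 , 4 , 3))) →
    (∀ e → e ∈ Linear3Graph.edges H → ¬ (_≥₃_ H (D H e) (5 , 4 , 2))) →
    ((∀ (v : Fin n) → deg H v ≡ 3 → degE₂ H v ≡ 0)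
     × (∀ (v : Fin n) → deg H v ≡ 2 → ¬ Special H v → degE₂ H v ≤ 1)
     × #Z₃ H ≤ #Y H)
proposition5p1 H _ no443 no542 =
  deg3⇒degE₂≡0 H no443 , deg2-nonspecial⇒degE₂≤1 H no542 , #Z₃≤#Y H
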